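{- Let $\alpha,\beta,\gamma\in\mathbf{H}$ be pairwise incomparable with respect to the subtree relation. Let $s,t\in\mathbf{H}$ be such that $\alpha$ is a subtree of neither $s$ nor $t$, and $\beta$ is a subtree of neither $s$ nor $t$. Let $n\ge1$ and $T\in\mathbf{H}$. Then $T\in\mathbb{M}^{\alpha,\beta,\gamma}_{s,t,n}$ if and only if (1) $\big\langle\gamma,\langle\tfrac{1}{\alpha,s},\tfrac{n}{\beta,t}\rangle\big\rangle\sqsubseteq T$, and (2) there exist $L\in\mathbb{N}^\alpha_s\cup\{\alpha\}$ and $R\in\mathbb{N}^\beta_t\cup\{\beta\}$ such that $$T=\Big\langle T\Big[\big\langle\gamma,\langle\tfrac{1}{\alpha,s},\tfrac{n}{\beta,t}\rangle\big\rangle\mapsto\gamma,\ \tfrac{1}{\alpha,s}\mapsto\alpha,\ \tfrac{n}{\beta,t}\mapsto\beta\Big],\ \langle L,R\rangle\Big\rangle.$$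
   Context: $\mathbf{H}$ is the set of finite full binary trees (variable-free terms over a constant $\perp$ and a binary function $\langle\cdot,\cdot\rangle$); $\sqsubseteq$ is the subtree relation. $t[r\mapsto s]$ is the tree obtained by replacing each occurrence of $r$ in $t$ by $s$; $t[r_1\mapsto s_1,\ldots,r_k\mapsto s_k]$ abbreviates the sequential substitution $t[r_1\mapsto s_1][r_2\mapsto s_2]\cdots[r_k\mapsto s_k]$. For $\alpha,s\in\mathbf{H}$ define $\tfrac{0}{\alpha,s}=\alpha$ and $\tfrac{m+1}{\alpha,s}=\langle\alpha,s\rangle\big[\alpha\mapsto\tfrac{m}{\alpha,s}\big]$, and $\mathbb{N}^\alpha_s=\{\tfrac{m}{\alpha,s}:m\ge1\}$; similarly for $\beta,t$. For $n\ge1$, $\mathbb{M}^{\alpha,\beta,\gamma}_{s,t,n}$ is the smallest subset of $\mathbf{H}$ such that $\big\langle\gamma,\langle\tfrac{1}{\alpha,s},\tfrac{n}{\beta,t}\rangle\big\rangle\in\mathbb{M}^{\alpha,\beta,\gamma}_{s,t,n}$, and whenever $T\in\mathbb{M}^{\alpha,\beta,\gamma}_{s,t,n}$ with $T=\big\langle R,\langle\tfrac{k}{\alpha,s},\tfrac{m}{\beta,t}\rangle\big\rangle$, then $\big\langle T,\langle\tfrac{k+1}{\alpha,s},\tfrac{m+n}{\beta,t}\rangle\big\rangle\in\mathbb{M}^{\alpha,\beta,\gamma}_{s,t,n}$. -}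

module Defs where

open import Data.Nat using (ℕ; zero; suc; _+_; _≥_)
open import Data.Product using (Σ; _×_; _,_)
open import Data.Sum using (_⊎_)
open import Relation.Nullary using (¬_; Dec; yes; no)
open import Relation.Binary.PropositionalEquality using (_≡_; refl; cong₂)

-- Finite full binary trees: terms over constant ⊥ and binary ⟨_,_⟩
data H : Set where
  ⊥ₕ   : H
  ⟨_,_⟩ : H → H → H

_≟ₕ_ : (x y : H) → Dec (x ≡ y)
⊥ₕ ≟ₕ ⊥ₕ = yes refl
⊥ₕ ≟ₕ ⟨ _ , _ ⟩ = no (λ ())
⟨ _ , _ ⟩ ≟ₕ ⊥ₕ = no (λ ())
⟨ a , b ⟩ ≟ₕ ⟨ c , d ⟩ with a ≟ₕ c | b ≟ₕ d
... | yes refl | yes refl = yes refl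
... | no p | _ = no (λ { refl → p refl })
... | yes _ | no q = no (λ { refl → q refl })

data _⊑_ : H → H → Set where
  ⊑-refl : ∀ {t} → t ⊑ t
  ⊑-left  : ∀ {r a b} → r ⊑ a → r ⊑ ⟨ a , b ⟩
  ⊑-right : ∀ {r a b} → r ⊑ b → r ⊑ ⟨ a , b ⟩

_[_↦_] : H → H → H → H
t [ r ↦ s ] with t ≟ₕ r
... | yes _ = s
t [ r ↦ s ] | no _ with t
... | ⊥ₕ = ⊥ₕ
... | ⟨ a , b ⟩ = ⟨ a [ r ↦ s ] , b [ r ↦ s ] ⟩

frac : ℕ → H → H → H
frac zero    α s = α
frac (suc m) α s = ⟨ α , s ⟩ [ α ↦ frac m α s ]

InN : H → H → H → Set
InN α s x = Σ ℕ λ m → m ≥ 1 × x ≡ frac m α s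

data InM (α β γ s t : H) (n : ℕ) : H → Set where
  base : InM α β γ s t n ⟨ γ , ⟨ frac 1 α s , frac n β t ⟩ ⟩
  step : ∀ R k m →
         InM α β γ s t n ⟨ R , ⟨ frac k α s , frac m β t ⟩ ⟩ →
         InM α β γ s t n
           ⟨ ⟨ R , ⟨ frac k α s , frac m β t ⟩ ⟩ ,
             ⟨ frac (suc k) α s , frac (m + n) β t ⟩ ⟩

-- Every element of 𝕄 has the form ⟨R, ⟨k/(α,s), m/(β,t)⟩⟩ with k ≥ 1, m ≥ n
-- and R either γ or again an element of 𝕄.  Since α ⋢ s, m/(α,s) is the left
-- comb ⟨…⟨α,s⟩…,s⟩ with m links, and replacing the comb with j links by α
-- inside the comb with q ≥ j links leaves q - j links.  So the substitution σ
-- of the statement sends ⟨γ, ⟨1/(α,s), n/(β,t)⟩⟩ to γ and otherwise lowers the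
-- top label from (k, m) to (k - 1, m - n) while recursing into R: it undoes one
-- closure step, and σ T = R for T ∈ 𝕄.  Conversely, if T = ⟨σ T, label⟩ then
-- σ T satisfies the same equation, hence lies in 𝕄 by induction, and comparing
-- its top label with the lowered one shows that T is one closure step above it.
module Submission where

open import Defs
open import Data.Nat using (ℕ; zero; suc; _+_; _∸_; _≤_; _≥_; z≤n; s≤s; _≤?_)
open import Data.Nat.Properties
  using (≤-refl; ≤-trans; ≤-antisym; m≤n⇒m≤1+n; <⇒≱; n≮n; m≤m+n; m≤n+m; +-comm; m+n∸n≡m; m∸n+n≡m)
open import Data.Product using (Σ; _×_; _,_)
open import Data.Sum using (_⊎_; inj₁; inj₂)
open import Data.Empty using (⊥-elim)
open import Relation.Nullary using (¬_; yes; no)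
open import Relation.Binary.PropositionalEquality
open import Function.Bundles using (_⇔_; mk⇔)

⟨,⟩-injectiveˡ : ∀ {a b c d} → ⟨ a , b ⟩ ≡ ⟨ c , d ⟩ → a ≡ c
⟨,⟩-injectiveˡ refl = refl

⟨,⟩-injectiveʳ : ∀ {a b c d} → ⟨ a , b ⟩ ≡ ⟨ c , d ⟩ → b ≡ d
⟨,⟩-injectiveʳ refl = refl

size : H → ℕ
size ⊥ₕ = 0
size ⟨ a , b ⟩ = suc (size a + size b)

≡⇒⊑ : ∀ {x y} → x ≡ y → x ⊑ y
≡⇒⊑ refl = ⊑-refl

⊑-trans : ∀ {x y z} → x ⊑ y → y ⊑ z → x ⊑ z
⊑-trans x⊑y ⊑-refl = x⊑y
⊑-trans x⊑y (⊑-left y⊑a) = ⊑-left (⊑-trans x⊑y y⊑a)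
⊑-trans x⊑y (⊑-right y⊑b) = ⊑-right (⊑-trans x⊑y y⊑b)

⊑⇒size≤ : ∀ {x y} → x ⊑ y → size x ≤ size y
⊑⇒size≤ ⊑-refl = ≤-refl
⊑⇒size≤ {y = ⟨ a , b ⟩} (⊑-left x⊑a) = m≤n⇒m≤1+n (≤-trans (⊑⇒size≤ x⊑a) (m≤m+n (size a) (size b)))
⊑⇒size≤ {y = ⟨ a , b ⟩} (⊑-right x⊑b) = m≤n⇒m≤1+n (≤-trans (⊑⇒size≤ x⊑b) (m≤n+m (size b) (size a)))

⟨,⟩⋢ˡ : ∀ {a b} → ¬ (⟨ a , b ⟩ ⊑ a)
⟨,⟩⋢ˡ {a} {b} p = <⇒≱ (s≤s (m≤m+n (size a) (size b))) (⊑⇒size≤ p)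

⊑-⟨,⟩-cases : ∀ {x a b} → x ⊑ ⟨ a , b ⟩ → x ≡ ⟨ a , b ⟩ ⊎ (x ⊑ a ⊎ x ⊑ b)
⊑-⟨,⟩-cases ⊑-refl = inj₁ refl
⊑-⟨,⟩-cases (⊑-left x⊑a) = inj₂ (inj₁ x⊑a)
⊑-⟨,⟩-cases (⊑-right x⊑b) = inj₂ (inj₂ x⊑b)

⋢-upward : ∀ {z x y} → z ⊑ x → ¬ (z ⊑ y) → ¬ (x ⊑ y)
⋢-upward z⊑x z⋢y x⊑y = z⋢y (⊑-trans z⊑x x⊑y)

⊑⋢⇒≢ : ∀ {z x y} → z ⊑ x → ¬ (z ⊑ y) → x ≢ y
⊑⋢⇒≢ z⊑x z⋢y refl = z⋢y z⊑x

⊑ˡ⇒≢ : ∀ {x a b} → x ⊑ a → ⟨ a , b ⟩ ≢ x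
⊑ˡ⇒≢ x⊑a refl = ⟨,⟩⋢ˡ x⊑a

[↦]-hit : ∀ r y → r [ r ↦ y ] ≡ y
[↦]-hit r y with r ≟ₕ r
... | yes _ = refl
... | no r≢r = ⊥-elim (r≢r refl)

[↦]-fresh : ∀ {r} x y → ¬ (r ⊑ x) → x [ r ↦ y ] ≡ x
[↦]-fresh {r} x y r⋢x with x ≟ₕ r
... | yes refl = ⊥-elim (r⋢x ⊑-refl)
[↦]-fresh ⊥ₕ y r⋢x | no _ = refl
[↦]-fresh ⟨ a , b ⟩ y r⋢x | no _ =
  cong₂ ⟨_,_⟩ ([↦]-fresh a y (λ p → r⋢x (⊑-left p))) ([↦]-fresh b y (λ p → r⋢x (⊑-right p)))

[↦]-⟨,⟩ : ∀ {r} a b y → ⟨ a , b ⟩ ≢ r → ⟨ a , b ⟩ [ r ↦ y ] ≡ ⟨ a [ r ↦ y ] , b [ r ↦ y ] ⟩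
[↦]-⟨,⟩ {r} a b y ab≢r with ⟨ a , b ⟩ ≟ₕ r
... | yes ab≡r = ⊥-elim (ab≢r ab≡r)
... | no _ = refl

peel : ℕ → ℕ → ℕ
peel j q with j ≤? q
... | yes _ = q ∸ j
... | no _ = q

peel-+ : ∀ j m → peel j (m + j) ≡ m
peel-+ j m with j ≤? m + j
... | yes _ = m+n∸n≡m m j
... | no j≰m+j = ⊥-elim (j≰m+j (m≤n+m j m))

peel⁻¹ : ∀ {j q m} → j ≤ m → peel j q ≡ m → q ≡ m + j
peel⁻¹ {j} {q} j≤m peel≡m with j ≤? q
... | yes j≤q = trans (sym (m∸n+n≡m j≤q)) (cong (_+ j) peel≡m)
... | no j≰q = ⊥-elim (j≰q (subst (j ≤_) (sym peel≡m) j≤m))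

InN⊎≡⇒frac : ∀ {a s x} → InN a s x ⊎ x ≡ a → Σ ℕ λ m → x ≡ frac m a s
InN⊎≡⇒frac (inj₁ (m , _ , x≡)) = m , x≡
InN⊎≡⇒frac (inj₂ x≡a) = 0 , x≡a

module Comb {a s : H} (a⋢s : ¬ (a ⊑ s)) where

  frac-suc : ∀ m → frac (suc m) a s ≡ ⟨ frac m a s , s ⟩
  frac-suc m = trans ([↦]-⟨,⟩ a s (frac m a s) (⊑ˡ⇒≢ ⊑-refl))
                     (cong₂ ⟨_,_⟩ ([↦]-hit a (frac m a s)) ([↦]-fresh s (frac m a s) a⋢s))

  ⊑-frac : ∀ m → a ⊑ frac m a s
  ⊑-frac zero = ⊑-refl
  ⊑-frac (suc m) rewrite frac-suc m = ⊑-left (⊑-frac m)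

  ⋢-frac : ∀ {x} → ¬ (x ⊑ a) → ¬ (x ⊑ s) → ¬ (a ⊑ x) → ∀ m → ¬ (x ⊑ frac m a s)
  ⋢-frac x⋢a x⋢s a⋢x zero = x⋢a
  ⋢-frac x⋢a x⋢s a⋢x (suc m) x⊑ rewrite frac-suc m with ⊑-⟨,⟩-cases x⊑
  ... | inj₁ refl = a⋢x (⊑-left (⊑-frac m))
  ... | inj₂ (inj₁ x⊑frac) = ⋢-frac x⋢a x⋢s a⋢x m x⊑frac
  ... | inj₂ (inj₂ x⊑s) = x⋢s x⊑s

  frac-⊑⇒≤ : ∀ k q → frac k a s ⊑ frac q a s → k ≤ q
  frac-⊑⇒≤ zero q _ = z≤n
  frac-⊑⇒≤ (suc k) zero p rewrite frac-suc k = ⊥-elim (⟨,⟩⋢ˡ (⊑-trans p (⊑-frac k)))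
  frac-⊑⇒≤ (suc k) (suc q) p rewrite frac-suc k | frac-suc q with ⊑-⟨,⟩-cases p
  ... | inj₁ e = s≤s (frac-⊑⇒≤ k q (≡⇒⊑ (⟨,⟩-injectiveˡ e)))
  ... | inj₂ (inj₁ p′) = m≤n⇒m≤1+n (frac-⊑⇒≤ (suc k) q (subst (_⊑ frac q a s) (sym (frac-suc k)) p′))
  ... | inj₂ (inj₂ p′) = ⊥-elim (a⋢s (⊑-trans (⊑-left (⊑-frac k)) p′))

  frac-injective : ∀ {k q} → frac k a s ≡ frac q a s → k ≡ q
  frac-injective {k} {q} e = ≤-antisym (frac-⊑⇒≤ k q (≡⇒⊑ e)) (frac-⊑⇒≤ q k (≡⇒⊑ (sym e)))

  frac-+-[↦] : ∀ j d → frac (d + j) a s [ frac j a s ↦ a ] ≡ frac d a s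
  frac-+-[↦] j zero = [↦]-hit (frac j a s) a
  frac-+-[↦] j (suc d) = begin
    frac (suc (d + j)) a s [ frac j a s ↦ a ]
      ≡⟨ cong (_[ frac j a s ↦ a ]) (frac-suc (d + j)) ⟩
    ⟨ frac (d + j) a s , s ⟩ [ frac j a s ↦ a ]
      ≡⟨ [↦]-⟨,⟩ (frac (d + j) a s) s a longer≢ ⟩
    ⟨ frac (d + j) a s [ frac j a s ↦ a ] , s [ frac j a s ↦ a ] ⟩
      ≡⟨ cong₂ ⟨_,_⟩ (frac-+-[↦] j d) ([↦]-fresh s a (⋢-upward (⊑-frac j) a⋢s)) ⟩
    ⟨ frac d a s , s ⟩
      ≡⟨ sym (frac-suc d) ⟩
    frac (suc d) a s ∎
    where
      open ≡-Reasoning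
      longer≢ : ⟨ frac (d + j) a s , s ⟩ ≢ frac j a s
      longer≢ e = n≮n j (≤-trans (s≤s (m≤n+m j d))
                                  (frac-⊑⇒≤ (suc (d + j)) j (≡⇒⊑ (trans (frac-suc (d + j)) e))))

  frac-[↦] : ∀ j q → frac q a s [ frac j a s ↦ a ] ≡ frac (peel j q) a s
  frac-[↦] j q with j ≤? q
  ... | yes j≤q = subst (λ q′ → frac q′ a s [ frac j a s ↦ a ] ≡ frac (q ∸ j) a s)
                        (m∸n+n≡m j≤q) (frac-+-[↦] j (q ∸ j))
  ... | no j≰q = [↦]-fresh (frac q a s) a (λ p → j≰q (frac-⊑⇒≤ j q p))

module Characterisation
  (α β γ s t : H)
  (α⋢β : ¬ (α ⊑ β)) (β⋢α : ¬ (β ⊑ α)) (α⋢γ : ¬ (α ⊑ γ)) (β⋢γ : ¬ (β ⊑ γ))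
  (α⋢s : ¬ (α ⊑ s)) (α⋢t : ¬ (α ⊑ t)) (β⋢s : ¬ (β ⊑ s)) (β⋢t : ¬ (β ⊑ t))
  (n : ℕ) (n≥1 : n ≥ 1) where

  module αs = Comb α⋢s
  module βt = Comb β⋢t

  A : ℕ → H
  A k = frac k α s

  B : ℕ → H
  B m = frac m β t

  G : H
  G = ⟨ γ , ⟨ A 1 , B n ⟩ ⟩

  σ : H → H
  σ T = T [ G ↦ γ ] [ A 1 ↦ α ] [ B n ↦ β ]

  M : H → Set
  M = InM α β γ s t n

  β⋢A : ∀ k → ¬ (β ⊑ A k)
  β⋢A = αs.⋢-frac β⋢α β⋢s α⋢β

  α⋢B : ∀ m → ¬ (α ⊑ B m)
  α⋢B = βt.⋢-frac α⋢β α⋢t β⋢α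

  α⊑label : ∀ k m → α ⊑ ⟨ A k , B m ⟩
  α⊑label k m = ⊑-left (αs.⊑-frac k)

  β⊑label : ∀ k m → β ⊑ ⟨ A k , B m ⟩
  β⊑label k m = ⊑-right (βt.⊑-frac m)

  G⋢label : ∀ k m → ¬ (G ⊑ ⟨ A k , B m ⟩)
  G⋢label k m G⊑ with ⊑-⟨,⟩-cases G⊑
  ... | inj₁ e = α⋢γ (subst (α ⊑_) (sym (⟨,⟩-injectiveˡ e)) (αs.⊑-frac k))
  ... | inj₂ (inj₁ G⊑A) = β⋢A k (⊑-trans (⊑-right (β⊑label 1 n)) G⊑A)
  ... | inj₂ (inj₂ G⊑B) = α⋢B m (⊑-trans (⊑-right (α⊑label 1 n)) G⊑B)

  σ-G : σ G ≡ γ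
  σ-G = begin
    G [ G ↦ γ ] [ A 1 ↦ α ] [ B n ↦ β ]
      ≡⟨ cong (λ x → x [ A 1 ↦ α ] [ B n ↦ β ]) ([↦]-hit G γ) ⟩
    γ [ A 1 ↦ α ] [ B n ↦ β ]
      ≡⟨ cong (_[ B n ↦ β ]) ([↦]-fresh γ α (⋢-upward (αs.⊑-frac 1) α⋢γ)) ⟩
    γ [ B n ↦ β ]
      ≡⟨ [↦]-fresh γ β (⋢-upward (βt.⊑-frac n) β⋢γ) ⟩
    γ ∎
    where open ≡-Reasoning

  [G↦γ]-labelled : ∀ X k m → ⟨ X , ⟨ A k , B m ⟩ ⟩ ≢ G →
    ⟨ X , ⟨ A k , B m ⟩ ⟩ [ G ↦ γ ] ≡ ⟨ X [ G ↦ γ ] , ⟨ A k , B m ⟩ ⟩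
  [G↦γ]-labelled X k m T≢G =
    trans ([↦]-⟨,⟩ X _ γ T≢G) (cong ⟨ X [ G ↦ γ ] ,_⟩ ([↦]-fresh _ γ (G⋢label k m)))

  [A₁↦α]-labelled : ∀ X k m →
    ⟨ X , ⟨ A k , B m ⟩ ⟩ [ A 1 ↦ α ] ≡ ⟨ X [ A 1 ↦ α ] , ⟨ A (peel 1 k) , B m ⟩ ⟩
  [A₁↦α]-labelled X k m = begin
    ⟨ X , ⟨ A k , B m ⟩ ⟩ [ A 1 ↦ α ]
      ≡⟨ [↦]-⟨,⟩ X _ α (⊑⋢⇒≢ (⊑-right (β⊑label k m)) (β⋢A 1)) ⟩
    ⟨ X [ A 1 ↦ α ] , ⟨ A k , B m ⟩ [ A 1 ↦ α ] ⟩
      ≡⟨ cong ⟨ X [ A 1 ↦ α ] ,_⟩ ([↦]-⟨,⟩ (A k) (B m) α (⊑⋢⇒≢ (β⊑label k m) (β⋢A 1))) ⟩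
    ⟨ X [ A 1 ↦ α ] , ⟨ A k [ A 1 ↦ α ] , B m [ A 1 ↦ α ] ⟩ ⟩
      ≡⟨ cong₂ (λ x y → ⟨ X [ A 1 ↦ α ] , ⟨ x , y ⟩ ⟩)
               (αs.frac-[↦] 1 k) ([↦]-fresh (B m) α (⋢-upward (αs.⊑-frac 1) (α⋢B m))) ⟩
    ⟨ X [ A 1 ↦ α ] , ⟨ A (peel 1 k) , B m ⟩ ⟩ ∎
    where open ≡-Reasoning

  [Bₙ↦β]-labelled : ∀ X k m →
    ⟨ X , ⟨ A k , B m ⟩ ⟩ [ B n ↦ β ] ≡ ⟨ X [ B n ↦ β ] , ⟨ A k , B (peel n m) ⟩ ⟩
  [Bₙ↦β]-labelled X k m = begin
    ⟨ X , ⟨ A k , B m ⟩ ⟩ [ B n ↦ β ]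
      ≡⟨ [↦]-⟨,⟩ X _ β (⊑⋢⇒≢ (⊑-right (α⊑label k m)) (α⋢B n)) ⟩
    ⟨ X [ B n ↦ β ] , ⟨ A k , B m ⟩ [ B n ↦ β ] ⟩
      ≡⟨ cong ⟨ X [ B n ↦ β ] ,_⟩ ([↦]-⟨,⟩ (A k) (B m) β (⊑⋢⇒≢ (α⊑label k m) (α⋢B n))) ⟩
    ⟨ X [ B n ↦ β ] , ⟨ A k [ B n ↦ β ] , B m [ B n ↦ β ] ⟩ ⟩
      ≡⟨ cong₂ (λ x y → ⟨ X [ B n ↦ β ] , ⟨ x , y ⟩ ⟩)
               ([↦]-fresh (A k) β (⋢-upward (βt.⊑-frac n) (β⋢A k))) (βt.frac-[↦] n m) ⟩
    ⟨ X [ B n ↦ β ] , ⟨ A k , B (peel n m) ⟩ ⟩ ∎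
    where open ≡-Reasoning

  σ-labelled : ∀ X k m → ⟨ X , ⟨ A k , B m ⟩ ⟩ ≢ G →
    σ ⟨ X , ⟨ A k , B m ⟩ ⟩ ≡ ⟨ σ X , ⟨ A (peel 1 k) , B (peel n m) ⟩ ⟩
  σ-labelled X k m T≢G = begin
    σ ⟨ X , ⟨ A k , B m ⟩ ⟩
      ≡⟨ cong (λ x → x [ A 1 ↦ α ] [ B n ↦ β ]) ([G↦γ]-labelled X k m T≢G) ⟩
    ⟨ X [ G ↦ γ ] , ⟨ A k , B m ⟩ ⟩ [ A 1 ↦ α ] [ B n ↦ β ]
      ≡⟨ cong (_[ B n ↦ β ]) ([A₁↦α]-labelled (X [ G ↦ γ ]) k m) ⟩
    ⟨ X [ G ↦ γ ] [ A 1 ↦ α ] , ⟨ A (peel 1 k) , B m ⟩ ⟩ [ B n ↦ β ]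
      ≡⟨ [Bₙ↦β]-labelled (X [ G ↦ γ ] [ A 1 ↦ α ]) (peel 1 k) m ⟩
    ⟨ σ X , ⟨ A (peel 1 k) , B (peel n m) ⟩ ⟩ ∎
    where open ≡-Reasoning

  G⊑M : ∀ {T} → M T → G ⊑ T
  G⊑M base = ⊑-refl
  G⊑M (step _ _ _ i) = ⊑-left (G⊑M i)

  M-labelled : ∀ {T} → M T →
    Σ H λ R → Σ ℕ λ k → Σ ℕ λ m → T ≡ ⟨ R , ⟨ A k , B m ⟩ ⟩ × 1 ≤ k × n ≤ m
  M-labelled base = γ , 1 , n , refl , ≤-refl , ≤-refl
  M-labelled (step R k m _) = _ , suc k , m + n , refl , s≤s z≤n , m≤n+m n m

  σ-M : ∀ {R P} → M ⟨ R , P ⟩ → σ ⟨ R , P ⟩ ≡ R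
  σ-M base = σ-G
  σ-M (step R k m i) = begin
    σ ⟨ Y , ⟨ A (suc k) , B (m + n) ⟩ ⟩
      ≡⟨ σ-labelled Y (suc k) (m + n) (⊑ˡ⇒≢ (G⊑M i)) ⟩
    ⟨ σ Y , ⟨ A (peel 1 (suc k)) , B (peel n (m + n)) ⟩ ⟩
      ≡⟨ cong₂ (λ x y → ⟨ x , ⟨ A (peel 1 y) , B (peel n (m + n)) ⟩ ⟩) (σ-M i) (+-comm 1 k) ⟩
    ⟨ R , ⟨ A (peel 1 (k + 1)) , B (peel n (m + n)) ⟩ ⟩
      ≡⟨ cong₂ (λ k′ m′ → ⟨ R , ⟨ A k′ , B m′ ⟩ ⟩) (peel-+ 1 k) (peel-+ n m) ⟩
    Y ∎
    where
      open ≡-Reasoning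
      Y = ⟨ R , ⟨ A k , B m ⟩ ⟩

  M-extend : ∀ {X R} k m → M X → X ≡ ⟨ R , ⟨ A (peel 1 k) , B (peel n m) ⟩ ⟩ →
    M ⟨ X , ⟨ A k , B m ⟩ ⟩
  M-extend k m i e with M-labelled i
  ... | R₀ , k₀ , m₀ , refl , 1≤k₀ , n≤m₀ =
    subst₂ (λ k′ m′ → M ⟨ _ , ⟨ A k′ , B m′ ⟩ ⟩) k≡ m≡ (step R₀ k₀ m₀ i)
    where
      k≡ : suc k₀ ≡ k
      k≡ = trans (+-comm 1 k₀)
             (sym (peel⁻¹ 1≤k₀ (sym (αs.frac-injective (⟨,⟩-injectiveˡ (⟨,⟩-injectiveʳ e))))))
      m≡ : m₀ + n ≡ m
      m≡ = sym (peel⁻¹ n≤m₀ (sym (βt.frac-injective (⟨,⟩-injectiveʳ (⟨,⟩-injectiveʳ e)))))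

  σ-fixed⇒M : ∀ T k m → G ⊑ T → T ≡ ⟨ σ T , ⟨ A k , B m ⟩ ⟩ → M T
  σ-fixed⇒M ⊥ₕ k m _ ()
  σ-fixed⇒M ⟨ X , Y ⟩ k m G⊑T e with ⟨,⟩-injectiveʳ e
  ... | refl with ⊑-⟨,⟩-cases G⊑T
  ...   | inj₁ G≡T = subst M G≡T base
  ...   | inj₂ (inj₂ G⊑label) = ⊥-elim (G⋢label k m G⊑label)
  ...   | inj₂ (inj₁ G⊑X) = M-extend k m (σ-fixed⇒M X (peel 1 k) (peel n m) G⊑X X-fixed) X-fixed
    where
      X-fixed : X ≡ ⟨ σ X , ⟨ A (peel 1 k) , B (peel n m) ⟩ ⟩
      X-fixed = trans (⟨,⟩-injectiveˡ e) (σ-labelled X k m (⊑ˡ⇒≢ G⊑X))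

  M⇔ : ∀ T → M T ⇔
    ((G ⊑ T) ×
     (Σ H λ L → Σ H λ R →
        (InN α s L ⊎ L ≡ α) × (InN β t R ⊎ R ≡ β) × (T ≡ ⟨ σ T , ⟨ L , R ⟩ ⟩)))
  M⇔ T = mk⇔ sound complete
    where
      sound : M T → _
      sound i with M-labelled i
      ... | R , k , m , refl , 1≤k , n≤m =
        G⊑M i , A k , B m , inj₁ (k , 1≤k , refl) , inj₁ (m , ≤-trans n≥1 n≤m , refl) ,
        cong ⟨_, ⟨ A k , B m ⟩ ⟩ (sym (σ-M i))
      complete : _ → M T
      complete (G⊑T , L , R , L∈ , R∈ , e) with InN⊎≡⇒frac L∈ | InN⊎≡⇒frac R∈
      ... | k , refl | m , refl = σ-fixed⇒M T k m G⊑T e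

lemma2 : (α β γ s t : H) →
    ¬ (α ⊑ β) → ¬ (β ⊑ α) → ¬ (α ⊑ γ) → ¬ (γ ⊑ α) → ¬ (β ⊑ γ) → ¬ (γ ⊑ β) →
    ¬ (α ⊑ s) → ¬ (α ⊑ t) → ¬ (β ⊑ s) → ¬ (β ⊑ t) →
    (n : ℕ) → n ≥ 1 → (T : H) →
    InM α β γ s t n T ⇔
      ((⟨ γ , ⟨ frac 1 α s , frac n β t ⟩ ⟩ ⊑ T) ×
       (Σ H λ L → Σ H λ R →
          (InN α s L ⊎ L ≡ α) × (InN β t R ⊎ R ≡ β) ×
          (T ≡ ⟨ T [ ⟨ γ , ⟨ frac 1 α s , frac n β t ⟩ ⟩ ↦ γ ] [ frac 1 α s ↦ α ] [ frac n β t ↦ β ] ,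
                 ⟨ L , R ⟩ ⟩)))
lemma2 α β γ s t α⋢β β⋢α α⋢γ _ β⋢γ _ α⋢s α⋢t β⋢s β⋢t n n≥1 =
  Characterisation.M⇔ α β γ s t α⋢β β⋢α α⋢γ β⋢γ α⋢s α⋢t β⋢s β⋢t n n≥1
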